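{- Let $G$ be a group, let $C$ be a finite cyclic subgroup of $G$, and let $\mathcal{X}$ be a finite set of integers greater than $1$. Then the set $\mathrm{Gen}(C)$ of generators of $C$ is a directed clique in the directed $\mathcal{X}$-excluded power graph $\vec{\mathcal{P}}_{ -\mathcal{X}}(G)$.
   Context: For a group $G$ and a set $\mathcal{X}$ of positive integers, the directed $\mathcal{X}$-excluded power graph $\vec{\mathcal{P}}_{ -\mathcal{X}}(G)$ has vertex set $G$ and a directed edge from $g$ to $h$ whenever $h\neq g$ and $h=g^k$ for some positive integer $k$ not divisible by any element of $\mathcal{X}$. A set of vertices of a digraph is a directed clique if there is a directed edge from each vertex of the set to every other vertex of the set. -}

module Defs where

open import Level using (Level; _⊔_)
open import Algebra.Bundles using (Group)
open import Data.Nat using (ℕ; zero; suc; _<_)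
open import Data.Nat.Divisibility using (_∣_)
open import Data.Integer using (ℤ; +_; -[1+_])
open import Data.List using (List)
open import Data.List.Membership.Propositional using (_∈_)
open import Data.List.Relation.Unary.Any using (Any)
open import Data.Product using (Σ; ∃; _×_; _,_)
open import Relation.Nullary using (¬_)
open import Function.Bundles using (_⇔_)

module _ {c ℓ : Level} (G : Group c ℓ) where
  open Group G

  pow : Carrier → ℕ → Carrier
  pow g zero    = ε
  pow g (suc n) = g ∙ pow g n

  zpow : Carrier → ℤ → Carrier
  zpow g (+ n)      = pow g n
  zpow g -[1+ n ]   = (pow g (suc n)) ⁻¹

  InCyclic : Carrier → Carrier → Set ℓ
  InCyclic g x = Σ ℤ λ z → x ≈ zpow g z

  record IsSubgroup {p : Level} (C : Carrier → Set p) : Set (c ⊔ ℓ ⊔ p) where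
    field
      resp  : ∀ {x y} → x ≈ y → C x → C y
      ε∈    : C ε
      ∙∈    : ∀ {x y} → C x → C y → C (x ∙ y)
      ⁻¹∈   : ∀ {x} → C x → C (x ⁻¹)

  IsCyclic : {p : Level} → (Carrier → Set p) → Set (c ⊔ ℓ ⊔ p)
  IsCyclic C = Σ Carrier λ g → ∀ x → C x ⇔ InCyclic g x

  IsFinite : {p : Level} → (Carrier → Set p) → Set (c ⊔ ℓ ⊔ p)
  IsFinite C = Σ (List Carrier) λ xs → ∀ x → C x → Any (x ≈_) xs

  Gen : {p : Level} → (Carrier → Set p) → Carrier → Set (c ⊔ ℓ ⊔ p)
  Gen C g = C g × (∀ x → C x ⇔ InCyclic g x)

  NotDivByAny : List ℕ → ℕ → Set
  NotDivByAny X k = ∀ x → x ∈ X → ¬ (x ∣ k)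

  Edge : List ℕ → Carrier → Carrier → Set ℓ
  Edge X g h = ¬ (h ≈ g) × Σ ℕ λ k → (0 < k) × NotDivByAny X k × (h ≈ pow g k)

  IsDirectedClique : {p : Level} → List ℕ → (Carrier → Set p) → Set (c ⊔ ℓ ⊔ p)
  IsDirectedClique X S = ∀ g h → S g → S h → ¬ (h ≈ g) → Edge X g h

{-# OPTIONS --safe #-}
-- If g and h both generate the finite group C, then h ≈ g ^ m and g ≈ h ^ w, so g ^ n ≈ ε for
-- n = w m - 1 (unless w m = 0, which forces g ≈ h ≈ ε), and m is coprime to n. Hence
-- h ≈ g ^ (m + n a) for every a, and choosing a as the part of P = ∏ X coprime to m makes
-- m + n a coprime to P, so no element of X divides that exponent.
module Submission where

open import Defs
open import Level using (Level)
open import Algebra.Bundles using (Group)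
open import Data.Nat using (ℕ; _<_)
open import Data.List using (List)
open import Data.List.Relation.Unary.All using (All)
open import Data.List.Relation.Unary.Unique.Propositional using (Unique)

open import Data.Nat.Base using (zero; suc; _+_; _*_; _^_; NonZero; >-nonZero; ≢-nonZero⁻¹; z<s; sz<ss; n>1⇒nonTrivial)
open import Data.Nat.Properties using (*-identityʳ; *-zeroʳ; *-suc; *-comm; *-assoc; +-comm; +-suc; <-trans; <-≤-trans; <-irrefl; m≤m+n; n<1+n; m≤n⇒∃[o]m+o≡n)
open import Data.Nat.Divisibility
open import Data.Nat.GCD using (gcd; gcd[m,n]∣m; gcd[m,n]∣n; gcd[m,n]≡0⇒m≡0)
open import Data.Nat.Coprimality as Coprimality using (Coprime; coprime?; gcd≡1⇒coprime; coprime-divisor; 1-coprimeTo)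
open import Data.Nat.Induction using (<-wellFounded)
open import Data.Nat.ListAction using (product)
open import Data.Nat.ListAction.Properties using (∈⇒∣product; product≢0)
open import Induction.WellFounded using (Acc; acc)
open import Data.Empty using (⊥-elim)
open import Data.Product using (∃; ∃₂; _×_; _,_; proj₁)
open import Data.Fin using (Fin; toℕ)
open import Data.Fin.Properties using (pigeonhole)
open import Data.List using (length; lookup)
open import Data.List.Membership.Propositional using (_∈_)
open import Data.List.Relation.Unary.Any using (Any; index)
open import Data.List.Relation.Unary.Any.Properties using (lookup-index)
import Data.List.Relation.Unary.All as All
open import Data.Integer using (+_; -[1+_])
open import Relation.Nullary using (¬_; yes; no; contradiction)
open import Relation.Binary.PropositionalEquality as ≡ using (_≡_)
open import Function.Bundles using (Equivalence)
import Algebra.Properties.Group as GroupProperties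
import Algebra.Properties.Monoid.Mult as MonoidMult
import Relation.Binary.Reasoning.Setoid as SetoidReasoning

private
  variable
    k m n o : ℕ

coprime-∣ʳ : Coprime k m → n ∣ m → Coprime k n
coprime-∣ʳ k⊥m n∣m (d∣k , d∣n) = k⊥m (d∣k , ∣-trans d∣n n∣m)

coprime-∣ˡ : Coprime k m → n ∣ k → Coprime n m
coprime-∣ˡ k⊥m n∣k (d∣n , d∣m) = k⊥m (∣-trans d∣n n∣k , d∣m)

coprime-* : Coprime k m → Coprime k n → Coprime k (m * n)
coprime-* k⊥m k⊥n (d∣k , d∣mn) = k⊥n (d∣k , coprime-divisor (coprime-∣ˡ k⊥m d∣k) d∣mn)

coprime-^ : ∀ j → Coprime k m → Coprime k (m ^ j)
coprime-^ {k} zero    _   = Coprimality.sym (1-coprimeTo k)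
coprime-^ (suc j) k⊥m = coprime-* k⊥m (coprime-^ j k⊥m)

¬coprime⇒1<gcd : .{{NonZero m}} → ¬ Coprime m n → 1 < gcd m n
¬coprime⇒1<gcd {m} {n} ¬m⊥n with gcd m n in eq
... | zero        = contradiction (gcd[m,n]≡0⇒m≡0 eq) (≢-nonZero⁻¹ m)
... | suc zero    = ⊥-elim (¬m⊥n (gcd≡1⇒coprime eq))
... | suc (suc _) = sz<ss

-- a is what remains of n after repeatedly dividing out gcd n m.
coprime-part : ∀ m n → .{{NonZero n}} → ∃₂ λ a j → Coprime a m × n ∣ a * m ^ j
coprime-part m n = go n (<-wellFounded n)
  where
  go : ∀ n → .{{NonZero n}} → Acc _<_ n → ∃₂ λ a j → Coprime a m × n ∣ a * m ^ j
  go n (acc rec) with coprime? n m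
  ... | yes n⊥m = n , 0 , n⊥m , ∣-reflexive (≡.sym (*-identityʳ n))
  ... | no ¬n⊥m = lift (go (quotient d∣n) (rec (quotient-< d∣n)))
    where
    d∣n = gcd[m,n]∣m n m
    instance
      _ = n>1⇒nonTrivial (¬coprime⇒1<gcd ¬n⊥m)
      _ = quotient≢0 d∣n
    lift : (∃₂ λ a j → Coprime a m × quotient d∣n ∣ a * m ^ j) → ∃₂ λ a j → Coprime a m × n ∣ a * m ^ j
    lift (a , j , a⊥m , q∣amʲ) = a , suc j , a⊥m , (begin
      n                       ≡⟨ m∣n⇒n≡quotient*m d∣n ⟩
      quotient d∣n * gcd n m  ∣⟨ *-pres-∣ q∣amʲ (gcd[m,n]∣n n m) ⟩
      a * m ^ j * m           ≡⟨ *-assoc a (m ^ j) m ⟩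
      a * (m ^ j * m)         ≡⟨ ≡.cong (a *_) (*-comm (m ^ j) m) ⟩
      a * m ^ suc j           ∎)
      where open ∣-Reasoning

coprime⇒∃[a]coprime[m+n*a,o] : Coprime m n → ∀ o → .{{NonZero o}} → ∃ λ a → Coprime (m + n * a) o
coprime⇒∃[a]coprime[m+n*a,o] {m} {n} m⊥n o with a , j , a⊥m , o∣amʲ ← coprime-part m o =
  a , coprime-∣ʳ (coprime-* k⊥a (coprime-^ j k⊥m)) o∣amʲ
  where
  k⊥a : Coprime (m + n * a) a
  k⊥a {d} (d∣k , d∣a) = a⊥m (d∣a , ∣m+n∣m⇒∣n (≡.subst (d ∣_) (+-comm m (n * a)) d∣k) (∣n⇒∣m*n n d∣a))
  k⊥m : Coprime (m + n * a) m
  k⊥m (d∣k , d∣m) = a⊥m (coprime-divisor (coprime-∣ˡ m⊥n d∣m) (∣m+n∣m⇒∣n d∣k d∣m) , d∣m)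

m*n≡1+o⇒0<n : ∀ m → m * n ≡ suc o → 0 < n
m*n≡1+o⇒0<n {zero}  m mn≡1+o with () ← ≡.trans (≡.sym (*-zeroʳ m)) mn≡1+o
m*n≡1+o⇒0<n {suc n} m _ = z<s

m*n≡1+o⇒coprime : ∀ m → m * n ≡ suc o → Coprime n o
m*n≡1+o⇒coprime {n} {o} m mn≡1+o {d} (d∣n , d∣o) =
  ∣1⇒≡1 (∣m+n∣m⇒∣n (≡.subst (d ∣_) (≡.trans mn≡1+o (+-comm 1 o)) (∣n⇒∣m*n m d∣n)) d∣o)

coprime[k,product]⇒∤ : ∀ {ns} → All (1 <_) ns → Coprime k (product ns) → ∀ x → x ∈ ns → ¬ x ∣ k
coprime[k,product]⇒∤ 1<ns k⊥∏ x x∈ns x∣k =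
  <-irrefl (≡.sym (k⊥∏ (x∣k , ∈⇒∣product x∈ns))) (All.lookup 1<ns x∈ns)

all>1⇒product≢0 : ∀ {ns} → All (1 <_) ns → NonZero (product ns)
all>1⇒product≢0 1<ns = product≢0 (All.map (λ 1<n → >-nonZero (<-trans z<s 1<n)) 1<ns)

module _ {c ℓ : Level} (G : Group c ℓ) where
  open Group G
  open GroupProperties G using (identityʳ-unique; inverseʳ-unique)
  open MonoidMult monoid using (×-congʳ; ×-homo-+; ×-assocˡ) renaming (_×_ to _×ᴳ_)
  open SetoidReasoning setoid

  private
    infixr 8 _^ᴳ_
    _^ᴳ_ : Carrier → ℕ → Carrier
    _^ᴳ_ = pow G

    variable
      g h x y : Carrier

  pow≡× : ∀ x n → x ^ᴳ n ≡ n ×ᴳ x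
  pow≡× x zero    = ≡.refl
  pow≡× x (suc n) = ≡.cong (x ∙_) (pow≡× x n)

  pow-cong : ∀ n → x ≈ y → x ^ᴳ n ≈ y ^ᴳ n
  pow-cong {x} {y} n x≈y rewrite pow≡× x n | pow≡× y n = ×-congʳ n x≈y

  pow-+ : ∀ x m n → x ^ᴳ (m + n) ≈ x ^ᴳ m ∙ x ^ᴳ n
  pow-+ x m n rewrite pow≡× x (m + n) | pow≡× x m | pow≡× x n = ×-homo-+ x m n

  pow-* : ∀ x m n → x ^ᴳ (m * n) ≈ (x ^ᴳ n) ^ᴳ m
  pow-* x m n rewrite pow≡× x (m * n) | pow≡× (x ^ᴳ n) m | pow≡× x n = sym (×-assocˡ x m n)

  pow-ε : ∀ n → ε ^ᴳ n ≈ ε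
  pow-ε zero    = refl
  pow-ε (suc n) = trans (identityˡ _) (pow-ε n)

  FiniteOrder : Carrier → Set ℓ
  FiniteOrder x = ∃ λ N → x ^ᴳ suc N ≈ ε

  pow-repeat⇒finiteOrder : ∀ {i j} → i < j → x ^ᴳ i ≈ x ^ᴳ j → FiniteOrder x
  pow-repeat⇒finiteOrder {x} {i} i<j xⁱ≈xʲ with N , ≡.refl ← m≤n⇒∃[o]m+o≡n i<j =
    N , identityʳ-unique (x ^ᴳ i) (x ^ᴳ suc N) (begin
      x ^ᴳ i ∙ x ^ᴳ suc N  ≈⟨ pow-+ x i (suc N) ⟨
      x ^ᴳ (i + suc N)     ≡⟨ ≡.cong (x ^ᴳ_) (+-suc i N) ⟩
      x ^ᴳ (suc i + N)     ≈⟨ xⁱ≈xʲ ⟨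
      x ^ᴳ i               ∎)

  pow-period⇒pow⁻¹ : ∀ N → x ^ᴳ suc N ≈ ε → ∀ n → (x ^ᴳ n) ⁻¹ ≈ x ^ᴳ (n * N)
  pow-period⇒pow⁻¹ {x} N period n = sym (inverseʳ-unique (x ^ᴳ n) (x ^ᴳ (n * N)) (begin
    x ^ᴳ n ∙ x ^ᴳ (n * N)  ≈⟨ pow-+ x n (n * N) ⟨
    x ^ᴳ (n + n * N)       ≡⟨ ≡.cong (x ^ᴳ_) (*-suc n N) ⟨
    x ^ᴳ (n * suc N)       ≈⟨ pow-* x n (suc N) ⟩
    (x ^ᴳ suc N) ^ᴳ n      ≈⟨ pow-cong n period ⟩
    ε ^ᴳ n                 ≈⟨ pow-ε n ⟩
    ε                      ∎))

  finiteOrder⇒InCyclic⇒pow : FiniteOrder x → InCyclic G x y → ∃ λ m → y ≈ x ^ᴳ m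
  finiteOrder⇒InCyclic⇒pow _            (+ n      , y≈xⁿ)  = n , y≈xⁿ
  finiteOrder⇒InCyclic⇒pow (N , period) (-[1+ n ] , y≈x⁻ⁿ) =
    suc n * N , trans y≈x⁻ⁿ (pow-period⇒pow⁻¹ N period (suc n))

  pow-period⇒pow-+* : ∀ n → x ^ᴳ n ≈ ε → ∀ m a → x ^ᴳ (m + n * a) ≈ x ^ᴳ m
  pow-period⇒pow-+* {x} n period m a = begin
    x ^ᴳ (m + n * a)         ≈⟨ pow-+ x m (n * a) ⟩
    x ^ᴳ m ∙ x ^ᴳ (n * a)    ≡⟨ ≡.cong (λ e → x ^ᴳ m ∙ x ^ᴳ e) (*-comm n a) ⟩
    x ^ᴳ m ∙ x ^ᴳ (a * n)    ≈⟨ ∙-congˡ (pow-* x a n) ⟩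
    x ^ᴳ m ∙ (x ^ᴳ n) ^ᴳ a   ≈⟨ ∙-congˡ (trans (pow-cong a period) (pow-ε a)) ⟩
    x ^ᴳ m ∙ ε               ≈⟨ identityʳ _ ⟩
    x ^ᴳ m                   ∎

  self-power⇒coprime-exponent : ∀ e m → g ≈ g ^ᴳ (e * m) → h ≈ g ^ᴳ m → ¬ h ≈ g →
                                ∀ o → .{{NonZero o}} → ∃ λ k → 0 < k × Coprime k o × h ≈ g ^ᴳ k
  self-power⇒coprime-exponent {g} {h} e m g≈gᵉᵐ h≈gᵐ h≉g o with e * m in em≡
  ... | zero = contradiction (begin
      h       ≈⟨ h≈gᵐ ⟩
      g ^ᴳ m  ≈⟨ pow-cong m g≈gᵉᵐ ⟩
      ε ^ᴳ m  ≈⟨ pow-ε m ⟩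
      ε       ≈⟨ g≈gᵉᵐ ⟨
      g       ∎) h≉g
  ... | suc n with a , k⊥o ← coprime⇒∃[a]coprime[m+n*a,o] (m*n≡1+o⇒coprime e em≡) o =
    m + n * a , <-≤-trans (m*n≡1+o⇒0<n e em≡) (m≤m+n m (n * a)) , k⊥o ,
    trans h≈gᵐ (sym (pow-period⇒pow-+* n gⁿ≈ε m a))
    where
    gⁿ≈ε : g ^ᴳ n ≈ ε
    gⁿ≈ε = identityʳ-unique g (g ^ᴳ n) (sym g≈gᵉᵐ)

  mutual-powers⇒coprime-exponent : ∀ m w → h ≈ g ^ᴳ m → g ≈ h ^ᴳ w → ¬ h ≈ g →
                                   ∀ o → .{{NonZero o}} → ∃ λ k → 0 < k × Coprime k o × h ≈ g ^ᴳ k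
  mutual-powers⇒coprime-exponent {h} {g} m w h≈gᵐ g≈hʷ =
    self-power⇒coprime-exponent w m (begin
      g                ≈⟨ g≈hʷ ⟩
      h ^ᴳ w           ≈⟨ pow-cong w h≈gᵐ ⟩
      (g ^ᴳ m) ^ᴳ w    ≈⟨ pow-* g w m ⟨
      g ^ᴳ (w * m)     ∎) h≈gᵐ

  module _ {p : Level} {C : Carrier → Set p} (sub : IsSubgroup G C) where
    open IsSubgroup sub

    pow∈ : ∀ n → C x → C (x ^ᴳ n)
    pow∈ zero    _   = ε∈
    pow∈ (suc n) x∈C = ∙∈ x∈C (pow∈ n x∈C)

    finite⇒finiteOrder : IsFinite G C → C x → FiniteOrder x
    finite⇒finiteOrder {x} (xs , cover) x∈C =
      let i , j , i<j , posᵢ≡posⱼ = pigeonhole (n<1+n (length xs)) position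
      in  pow-repeat⇒finiteOrder i<j (begin
        x ^ᴳ toℕ i              ≈⟨ lookup-index (occurs i) ⟩
        lookup xs (position i)  ≡⟨ ≡.cong (lookup xs) posᵢ≡posⱼ ⟩
        lookup xs (position j)  ≈⟨ lookup-index (occurs j) ⟨
        x ^ᴳ toℕ j              ∎)
      where
      occurs : (i : Fin (suc (length xs))) → Any (x ^ᴳ toℕ i ≈_) xs
      occurs i = cover _ (pow∈ (toℕ i) x∈C)
      position : Fin (suc (length xs)) → Fin (length xs)
      position i = index (occurs i)

    Gen⇒pow : IsFinite G C → Gen G C g → C x → ∃ λ m → x ≈ g ^ᴳ m
    Gen⇒pow fin (g∈C , C⇔⟨g⟩) x∈C =
      finiteOrder⇒InCyclic⇒pow (finite⇒finiteOrder fin g∈C) (Equivalence.to (C⇔⟨g⟩ _) x∈C)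

corollary3p2 : {c ℓ p : Level} (G : Group c ℓ) (C : Group.Carrier G → Set p)
    → IsSubgroup G C → IsCyclic G C → IsFinite G C
    → (X : List ℕ) → Unique X → All (1 <_) X
    → IsDirectedClique G X (Gen G C)
-- Cyclicity of C is implied by the existence of a generator, and repetitions in X are harmless.
corollary3p2 G C sub _ fin X _ 1<X g h g∈Gen h∈Gen h≉g
  with m , h≈gᵐ ← Gen⇒pow G sub fin g∈Gen (proj₁ h∈Gen)
     | w , g≈hʷ ← Gen⇒pow G sub fin h∈Gen (proj₁ g∈Gen)
  with k , 0<k , k⊥∏X , h≈gᵏ ← mutual-powers⇒coprime-exponent G m w h≈gᵐ g≈hʷ h≉g
                                 (product X) {{all>1⇒product≢0 1<X}} =
  h≉g , k , 0<k , coprime[k,product]⇒∤ 1<X k⊥∏X , h≈gᵏ
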